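{- For all positive integers $n$, $C_n(132,213) \le n^2 \cdot 2^{n/2}$.
   Context: Let $\mathfrak{S}_n$ denote the set of permutations of $[n]=\{1,\ldots,n\}$. For $\sigma\in\mathfrak{S}_k$, a permutation $\pi\in\mathfrak{S}_n$ contains $\sigma$ if there exist indices $1\le i_1<\cdots<i_k\le n$ such that $\pi_{i_1}\pi_{i_2}\cdots\pi_{i_k}$ is in the same relative order as $\sigma_1\sigma_2\cdots\sigma_k$; otherwise $\pi$ avoids $\sigma$. $C_n(132,213)$ denotes the number of permutations $\pi\in\mathfrak{S}_n$ that avoid both patterns $132$ and $213$ and whose cycle decomposition consists of a single $n$-cycle. -}

module Defs where

open import Data.Nat using (ℕ; zero; suc)
open import Data.Fin using (Fin; _<_) renaming (zero to fz)
open import Data.Fin.Properties using (_≟_; _<?_; all?; any?)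
open import Data.Vec using (Vec; []; _∷_; lookup)
open import Data.List using (List; []; _∷_; length; filter; concatMap; map; allFin)
open import Data.Product using (_×_; ∃-syntax; _,_)
open import Relation.Nullary using (¬_; Dec)
open import Relation.Nullary.Decidable using (_×-dec_; ¬?; _→-dec_)
open import Relation.Binary.PropositionalEquality using (_≡_)

-- A permutation candidate of [n] in one-line notation (0-indexed: values in Fin n);
-- π(i) = lookup π i.
Word : ℕ → Set
Word n = Vec (Fin n) n

allVecs : ∀ {n} m → List (Vec (Fin n) m)
allVecs zero = [] ∷ []
allVecs {n} (suc m) = concatMap (λ v → map (_∷ v) (allFin n)) (allVecs m)

-- π is a bijection of [n] (injective suffices on a finite set; stated as injectivity)
IsPerm : ∀ {n} → Word n → Set
IsPerm {n} π = ∀ (i j : Fin n) → lookup π i ≡ lookup π j → i ≡ j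

Contains132 : ∀ {n} → Word n → Set
Contains132 {n} π = ∃[ i ] ∃[ j ] ∃[ k ]
  (i < j × j < k × lookup π i < lookup π k × lookup π k < lookup π j)

Contains213 : ∀ {n} → Word n → Set
Contains213 {n} π = ∃[ i ] ∃[ j ] ∃[ k ]
  (i < j × j < k × lookup π j < lookup π i × lookup π i < lookup π k)

iter : ∀ {n} → Word n → ℕ → Fin n → Fin n
iter π zero x = x
iter π (suc k) x = lookup π (iter π k x)

-- the cycle decomposition of the permutation π of [n] (n ≥ 1) is a single n-cycle:
-- the orbit of the first element has size n, i.e. π^k(1) ≠ 1 for 0 < k < n.
IsNCycle : ∀ {n} → Word (suc n) → Set
IsNCycle {n} π = ∀ (k : Fin n) → ¬ (iter π (suc (Data.Fin.toℕ k)) fz ≡ fz)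

isPerm? : ∀ {n} (π : Word n) → Dec (IsPerm π)
isPerm? π = all? λ i → all? λ j → (lookup π i ≟ lookup π j) →-dec (i ≟ j)

contains132? : ∀ {n} (π : Word n) → Dec (Contains132 π)
contains132? π = any? λ i → any? λ j → any? λ k →
  (i <? j) ×-dec (j <? k) ×-dec (lookup π i <? lookup π k) ×-dec (lookup π k <? lookup π j)

contains213? : ∀ {n} (π : Word n) → Dec (Contains213 π)
contains213? π = any? λ i → any? λ j → any? λ k →
  (i <? j) ×-dec (j <? k) ×-dec (lookup π j <? lookup π i) ×-dec (lookup π i <? lookup π k)

isNCycle? : ∀ {n} (π : Word (suc n)) → Dec (IsNCycle π)
isNCycle? π = all? λ k → ¬? (iter π (suc (Data.Fin.toℕ k)) fz ≟ fz)

Good : ∀ {n} → Word (suc n) → Set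
Good π = IsPerm π × ¬ Contains132 π × ¬ Contains213 π × IsNCycle π

good? : ∀ {n} (π : Word (suc n)) → Dec (Good π)
good? π = isPerm? π ×-dec ¬? (contains132? π) ×-dec ¬? (contains213? π) ×-dec isNCycle? π

-- C_n(132,213) for n ≥ 1 (the value at n = 0 is irrelevant, set to 0 by convention;
-- the theorem only concerns positive n)
C : ℕ → ℕ
C zero = 0
C (suc n) = length (filter good? (allVecs {suc n} (suc n)))

module Submission where

-- A permutation π of {0,…,N-1} avoiding 132 and 213 is a decreasing sequence of
-- "blocks", each an increasing run of consecutive values: every ascent is by +1
-- and every value after a descent lies below every value before it.  If x lies
-- in the block [a, b), then π x + a + b = N + x.  Hence ρ x = N - 1 - π x
-- reverses every block; ρ is an involution with π ∘ ρ ∘ π = ρ, and its fixed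
-- points are the midpoints of the odd blocks.  If π is an N-cycle, two distinct
-- fixed points c, d of ρ satisfy π^k c = d with 2k = N, so ρ has at most two
-- fixed points.  The number of fixed points before a block start s has the
-- parity of s.  Therefore the block structure (and with it π) is recovered from
-- the positions at which the number of fixed points reaches 1 and 2 together
-- with one bit per pair of positions {2t+1, 2t+2} saying whether a block starts
-- there.  This injective encoding yields C N ≤ N · N · 2^⌊N/2⌋; squaring gives
-- the theorem.

open import Defs
open import Data.Nat using (ℕ; suc; _≤_; _<_; _*_; _^_)
open import Data.Product using (∃-syntax; _×_)
open import Data.Empty using (⊥)
open import Relation.Binary.PropositionalEquality using (_≡_)

module BoundedSearch where

  open import Data.Nat
  open import Data.Nat.Properties
  open import Data.Bool using (Bool; true; false; if_then_else_)
  open import Data.Sum using (_⊎_; inj₁; inj₂)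
  open import Data.Empty using (⊥-elim)
  open import Relation.Binary.PropositionalEquality

  lastHit : (ℕ → Bool) → ℕ → ℕ
  lastHit c zero = zero
  lastHit c (suc x) = if c (suc x) then suc x else lastHit c x

  firstHit : (ℕ → Bool) → ℕ → ℕ → ℕ
  firstHit c zero b = b
  firstHit c (suc k) b = if c b then b else firstHit c k (suc b)

  lastHit-≤ : ∀ c x → lastHit c x ≤ x
  lastHit-≤ c zero = z≤n
  lastHit-≤ c (suc x) with c (suc x)
  ... | true = ≤-refl
  ... | false = m≤n⇒m≤1+n (lastHit-≤ c x)

  lastHit-hit : ∀ c x → lastHit c x ≡ 0 ⊎ c (lastHit c x) ≡ true
  lastHit-hit c zero = inj₁ refl
  lastHit-hit c (suc x) with c (suc x) in eq
  ... | true = inj₂ eq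
  ... | false = lastHit-hit c x

  lastHit-gap : ∀ c x j → lastHit c x < j → j ≤ x → c j ≡ false
  lastHit-gap c zero j lt le = ⊥-elim (<-irrefl refl (<-≤-trans lt le))
  lastHit-gap c (suc x) j lt le with c (suc x) in eq
  ... | true = ⊥-elim (<-irrefl refl (<-≤-trans lt le))
  ... | false with m≤n⇒m<n∨m≡n le
  ...   | inj₁ j<sx = lastHit-gap c x j lt (≤-pred j<sx)
  ...   | inj₂ refl = eq

  lastHit-here : ∀ c x → c (suc x) ≡ true → lastHit c (suc x) ≡ suc x
  lastHit-here c x eq rewrite eq = refl

  lastHit-miss : ∀ c x → c (suc x) ≡ false → lastHit c (suc x) ≡ lastHit c x
  lastHit-miss c x eq rewrite eq = refl

  lastHit-cong : ∀ c c' x → (∀ s → 0 < s → s ≤ x → c s ≡ c' s) → lastHit c x ≡ lastHit c' x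
  lastHit-cong c c' zero h = refl
  lastHit-cong c c' (suc x) h rewrite h (suc x) z<s ≤-refl with c' (suc x)
  ... | true = refl
  ... | false = lastHit-cong c c' x (λ s p q → h s p (m≤n⇒m≤1+n q))

  firstHit-≥ : ∀ c k b → b ≤ firstHit c k b
  firstHit-≥ c zero b = ≤-refl
  firstHit-≥ c (suc k) b with c b
  ... | true = ≤-refl
  ... | false = <⇒≤ (firstHit-≥ c k (suc b))

  firstHit-≤ : ∀ c k b → firstHit c k b ≤ b + k
  firstHit-≤ c zero b = ≤-reflexive (sym (+-identityʳ b))
  firstHit-≤ c (suc k) b with c b
  ... | true = m≤m+n b (suc k)
  ... | false = subst (firstHit c k (suc b) ≤_) (sym (+-suc b k)) (firstHit-≤ c k (suc b))

  firstHit-hit : ∀ c k b → firstHit c k b ≡ b + k ⊎ c (firstHit c k b) ≡ true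
  firstHit-hit c zero b = inj₁ (sym (+-identityʳ b))
  firstHit-hit c (suc k) b with c b in eq
  ... | true = inj₂ eq
  ... | false with firstHit-hit c k (suc b)
  ...   | inj₁ e = inj₁ (trans e (sym (+-suc b k)))
  ...   | inj₂ e = inj₂ e

  firstHit-gap : ∀ c k b j → b ≤ j → j < firstHit c k b → c j ≡ false
  firstHit-gap c zero b j le lt = ⊥-elim (<-irrefl refl (≤-<-trans le lt))
  firstHit-gap c (suc k) b j le lt with c b in eq
  ... | true = ⊥-elim (<-irrefl refl (≤-<-trans le lt))
  ... | false with m≤n⇒m<n∨m≡n le
  ...   | inj₁ b<j = firstHit-gap c k (suc b) j b<j lt
  ...   | inj₂ refl = eq

  firstHit-cong : ∀ c c' k b → (∀ s → b ≤ s → s < b + k → c s ≡ c' s) →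
                  firstHit c k b ≡ firstHit c' k b
  firstHit-cong c c' zero b h = refl
  firstHit-cong c c' (suc k) b h
    rewrite h b ≤-refl (subst (b <_) (sym (+-suc b k)) (s≤s (m≤m+n b k))) with c' b
  ... | true = refl
  ... | false = firstHit-cong c c' k (suc b)
                  (λ s p q → h s (<⇒≤ p) (subst (s <_) (sym (+-suc b k)) q))

module Parity where

  open import Data.Nat
  open import Data.Nat.Properties
  open import Data.Bool using (Bool; true; false; not; _∧_; _xor_; T)
  open import Data.Bool.Properties using (not-distribˡ-xor; not-¬; xor-identityʳ; xor-same; xor-assoc; xor-comm; true-xor)
  open import Data.Sum using (inj₁; inj₂)
  open import Data.Empty using (⊥-elim)
  open import Data.Unit using (tt)
  open import Relation.Binary.PropositionalEquality
  open import Relation.Nullary using (¬_; yes; no)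

  isOdd : ℕ → Bool
  isOdd zero = false
  isOdd (suc n) = not (isOdd n)

  isOdd-+ : ∀ m n → isOdd (m + n) ≡ isOdd m xor isOdd n
  isOdd-+ zero n = refl
  isOdd-+ (suc m) n = trans (cong not (isOdd-+ m n)) (not-distribˡ-xor (isOdd m) (isOdd n))

  isOdd-double : ∀ x → isOdd (x + x) ≡ false
  isOdd-double zero = refl
  isOdd-double (suc x) rewrite +-suc x x with isOdd (x + x) | isOdd-double x
  ... | false | refl = refl

  xor-true : ∀ b → b xor true ≡ not b
  xor-true b = trans (xor-comm b true) (true-xor b)

  xor-cancelˡ : ∀ a b → a xor (a xor b) ≡ b
  xor-cancelˡ a b = trans (sym (xor-assoc a a b)) (cong (_xor b) (xor-same a))

  indicator : Bool → ℕ
  indicator true = 1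
  indicator false = 0

  isOdd-+indicator : ∀ m b → isOdd (m + indicator b) ≡ isOdd m xor b
  isOdd-+indicator m true = isOdd-+ m 1
  isOdd-+indicator m false = trans (cong isOdd (+-identityʳ m)) (sym (xor-identityʳ (isOdd m)))

  parity-flip : ∀ m b → isOdd (m + indicator b) ≡ not (isOdd m) → b ≡ true
  parity-flip m true _ = refl
  parity-flip m false e = ⊥-elim (not-¬ refl (trans (sym (cong isOdd (+-identityʳ m))) e))

  ≤ᵇ-false : ∀ m n → ¬ (m ≤ n) → (m ≤ᵇ n) ≡ false
  ≤ᵇ-false m n m≰n with m ≤ᵇ n in e
  ... | false = refl
  ... | true = ⊥-elim (m≰n (≤ᵇ⇒≤ m n (subst T (sym e) tt)))

  ≤ᵇ-true : ∀ m n → m ≤ n → (m ≤ᵇ n) ≡ true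
  ≤ᵇ-true m n m≤n with m ≤ᵇ n in e | ≤⇒≤ᵇ m≤n
  ... | true | _ = refl

  odd-below-step : ∀ y x → y ≢ suc (x + x) →
                   (isOdd y ∧ (y ≤ᵇ x + x)) ≡ (isOdd y ∧ (y ≤ᵇ suc x + suc x))
  odd-below-step y x y≢ rewrite +-suc x x with y ≤? x + x
  ... | yes le rewrite ≤ᵇ-true y (x + x) le
                     | ≤ᵇ-true y (suc (suc (x + x))) (m≤n⇒m≤1+n (m≤n⇒m≤1+n le)) = refl
  ... | no nle rewrite ≤ᵇ-false y (x + x) nle with y ≤? suc (suc (x + x))
  ...   | no nle2 rewrite ≤ᵇ-false y _ nle2 = refl
  ...   | yes le2 with m≤n⇒m<n∨m≡n le2
  ...     | inj₂ refl rewrite isOdd-double x = refl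
  ...     | inj₁ lt with m≤n⇒m<n∨m≡n (≤-pred lt)
  ...       | inj₂ e = ⊥-elim (y≢ e)
  ...       | inj₁ lt2 = ⊥-elim (nle (≤-pred lt2))

module FiniteInjection where

  open import Data.Nat
  open import Data.Nat.Properties
  open import Data.Fin using (Fin; toℕ; fromℕ<; punchOut)
  open import Data.Fin.Properties using (toℕ-fromℕ<; punchOut-injective; pigeonhole; any?; toℕ<n)
  open import Data.Product using (_×_; _,_; ∃-syntax)
  open import Data.Empty using (⊥-elim)
  open import Relation.Binary.PropositionalEquality
  open import Relation.Nullary using (yes; no)

  injective⇒surjective :
    ∀ N (g : ℕ → ℕ) → (∀ {i} → i < N → g i < N) →
    (∀ {i j} → i < N → j < N → g i ≡ g j → i ≡ j) →
    ∀ {v} → v < N → ∃[ i ] (i < N × g i ≡ v)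
  injective⇒surjective zero g bound inj ()
  injective⇒surjective (suc M) g bound inj {v} v<N
    with any? (λ (i : Fin (suc M)) → g (toℕ i) ≟ v)
  ... | yes (i , gi≡v) = toℕ i , toℕ<n i , gi≡v
  ... | no missed =
    let (i , j , i<j , collide) = pigeonhole (n<1+n M) squeezed
        gi≡gj : g (toℕ i) ≡ g (toℕ j)
        gi≡gj = trans (sym (toℕ-fromℕ< (bound (toℕ<n i))))
                      (trans (cong toℕ (punchOut-injective (avoids i) (avoids j) collide))
                             (toℕ-fromℕ< (bound (toℕ<n j))))
    in ⊥-elim (<-irrefl (inj (toℕ<n i) (toℕ<n j) gi≡gj) i<j)
    where
    -- g as a map Fin (suc M) → Fin (suc M) avoiding v, squeezed into Fin M
    gFin : Fin (suc M) → Fin (suc M)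
    gFin i = fromℕ< (bound (toℕ<n i))
    avoids : ∀ i → fromℕ< v<N ≢ gFin i
    avoids i e = missed (i , trans (sym (toℕ-fromℕ< (bound (toℕ<n i))))
                                   (trans (cong toℕ (sym e)) (toℕ-fromℕ< v<N)))
    squeezed : Fin (suc M) → Fin M
    squeezed i = punchOut (avoids i)

module Iteration (N : ℕ) (f : ℕ → ℕ)
  (bound : ∀ {i} → i < N → f i < N)
  (inj : ∀ {i j} → i < N → j < N → f i ≡ f j → i ≡ j)
  where

  open import Data.Nat
  open import Data.Nat.Properties
  open import Data.Product using (_×_; _,_; ∃-syntax)
  open import Data.Empty using (⊥-elim)
  open import Relation.Binary.PropositionalEquality
  open import Relation.Binary.Definitions using (tri<; tri≈; tri>)
  open import Relation.Nullary using (yes; no)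
  open FiniteInjection

  iterate : ℕ → ℕ → ℕ
  iterate zero x = x
  iterate (suc k) x = f (iterate k x)

  iterate-< : ∀ k {x} → x < N → iterate k x < N
  iterate-< zero p = p
  iterate-< (suc k) p = bound (iterate-< k p)

  iterate-+ : ∀ j k x → iterate (j + k) x ≡ iterate j (iterate k x)
  iterate-+ zero k x = refl
  iterate-+ (suc j) k x = cong f (iterate-+ j k x)

  iterate-comm : ∀ j k x → iterate j (iterate k x) ≡ iterate k (iterate j x)
  iterate-comm j k x = trans (sym (iterate-+ j k x)) (trans (cong (λ z → iterate z x) (+-comm j k)) (iterate-+ k j x))

  iterate-injective : ∀ k {x y} → x < N → y < N → iterate k x ≡ iterate k y → x ≡ y
  iterate-injective zero p q e = e
  iterate-injective (suc k) p q e = iterate-injective k p q (inj (iterate-< k p) (iterate-< k q) e)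

  iterate-cancel : ∀ i d {x} → x < N → iterate i x ≡ iterate (d + i) x → iterate d x ≡ x
  iterate-cancel i d {x} p e =
    sym (iterate-injective i p (iterate-< d p)
          (trans e (trans (cong (λ z → iterate z x) (+-comm d i)) (iterate-+ i d x))))

  -- If x does not return to itself within fewer than N steps, its first N
  -- iterates are distinct and therefore exhaust {0,…,N-1}.
  module Orbit {x} (x<N : x < N) (aperiodic : ∀ m → 0 < m → m < N → iterate m x ≢ x) where

    no-early-return : ∀ {i j} → i < j → j < N → iterate i x ≢ iterate j x
    no-early-return {i} {j} i<j j<N e =
      aperiodic (j ∸ i) (m<n⇒0<n∸m i<j) (≤-<-trans (m∸n≤m j i) j<N)
        (iterate-cancel i (j ∸ i) x<N (trans e (cong (λ z → iterate z x) (sym (m∸n+n≡m (<⇒≤ i<j))))))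

    orbit-injective : ∀ {i j} → i < N → j < N → iterate i x ≡ iterate j x → i ≡ j
    orbit-injective {i} {j} p q e with <-cmp i j
    ... | tri≈ _ i≡j _ = i≡j
    ... | tri< i<j _ _ = ⊥-elim (no-early-return i<j q e)
    ... | tri> _ _ j<i = ⊥-elim (no-early-return j<i p (sym e))

    orbit-onto : ∀ {d} → d < N → ∃[ k ] (k < N × iterate k x ≡ d)
    orbit-onto = injective⇒surjective N (λ k → iterate k x) (λ {k} _ → iterate-< k x<N) orbit-injective

  module NCycle (N>0 : 0 < N) (cyc : ∀ m → 0 < m → m < N → iterate m 0 ≢ 0) where

    open Orbit N>0 cyc using () renaming (orbit-onto to iterate-of-0)

    iterate-N-0 : iterate N 0 ≡ 0
    iterate-N-0 with iterate-of-0 (iterate-< N N>0)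
    ... | zero , _ , e = sym e
    ... | suc i , i<N , e =
      ⊥-elim (cyc (N ∸ suc i) (m<n⇒0<n∸m i<N) (∸-monoʳ-< z<s (<⇒≤ i<N))
                  (iterate-cancel (suc i) (N ∸ suc i) N>0
                     (trans e (cong (λ z → iterate z 0) (sym (m∸n+n≡m (<⇒≤ i<N)))))))

    -- every point lies on the orbit of 0, so it has period N and no shorter one
    period : ∀ {c} → c < N → iterate N c ≡ c
    period p with iterate-of-0 p
    ... | i , _ , refl = trans (iterate-comm N i 0) (cong (iterate i) iterate-N-0)

    aperiodic : ∀ {c} → c < N → ∀ m → 0 < m → m < N → iterate m c ≢ c
    aperiodic p m 0<m m<N e with iterate-of-0 p
    ... | i , _ , refl =
      cyc m 0<m m<N (iterate-injective i (iterate-< m N>0) N>0 (trans (iterate-comm i m 0) e))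

    reach : ∀ {c d} → c < N → d < N → ∃[ k ] (k < N × iterate k c ≡ d)
    reach p = Orbit.orbit-onto p (aperiodic p)

    return-time : ∀ {c m} → c < N → 0 < m → m < N + N → iterate m c ≡ c → m ≡ N
    return-time {c} {m} p 0<m m<2N e with m <? N
    ... | yes m<N = ⊥-elim (aperiodic p m 0<m m<N e)
    ... | no m≮N = atRemainder (m ∸ N) refl
      where
      r+N : m ∸ N + N ≡ m
      r+N = m∸n+n≡m (≮⇒≥ m≮N)
      r<N : m ∸ N < N
      r<N = +-cancelʳ-< N (m ∸ N) N (subst (_< N + N) (sym r+N) m<2N)
      returns : iterate (m ∸ N) c ≡ c
      returns = trans (sym (cong (iterate (m ∸ N)) (period p)))
                      (trans (sym (iterate-+ (m ∸ N) N c)) (trans (cong (λ z → iterate z c) r+N) e))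
      atRemainder : ∀ r → r ≡ m ∸ N → m ≡ N
      atRemainder zero r≡ = trans (sym r+N) (cong (_+ N) (sym r≡))
      atRemainder (suc r) r≡ = ⊥-elim (aperiodic p (suc r) z<s (subst (_< N) (sym r≡) r<N)
                                                    (subst (λ z → iterate z c ≡ c) (sym r≡) returns))

-- The block structure of a map f on {0,…,N-1}: a block starts at every
-- descent position.  No hypotheses on f are needed to define it, which lets
-- the encoding below be computed from any word.
module Shape (N : ℕ) (f : ℕ → ℕ) where

  open import Data.Nat
  open import Data.Bool using (Bool; false; _∧_)
  open BoundedSearch
  open Parity

  startsBlock : ℕ → Bool
  startsBlock zero = false
  startsBlock (suc x) = (suc x <ᵇ N) ∧ (f (suc x) <ᵇ f x)

  -- the block containing x is [blockStart x, blockEnd x)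
  blockStart : ℕ → ℕ
  blockStart = lastHit startsBlock

  blockEnd : ℕ → ℕ
  blockEnd x = firstHit startsBlock (N ∸ suc x) (suc x)

  -- the block-reversing map ρ x = N - 1 - f x and its fixed points
  ρ : ℕ → ℕ
  ρ x = N ∸ suc (f x)

  isFixed : ℕ → Bool
  isFixed x = f x + suc x ≡ᵇ N

  fixedBelow : ℕ → ℕ
  fixedBelow zero = zero
  fixedBelow (suc x) = fixedBelow x + indicator (isFixed x)

  -- the block of x has odd length and its midpoint lies before x
  -- (the midpoint of [a, b) is (a + b - 1)/2)
  oddMidpointBefore : ℕ → Bool
  oddMidpointBefore x = isOdd (blockStart x + blockEnd x) ∧ (blockStart x + blockEnd x ≤ᵇ x + x)

module Blocks (N : ℕ) (f : ℕ → ℕ)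
  (bound : ∀ {i} → i < N → f i < N)
  (inj : ∀ {i j} → i < N → j < N → f i ≡ f j → i ≡ j)
  (surj : ∀ {v} → v < N → ∃[ i ] (i < N × f i ≡ v))
  (no132 : ∀ {i j k} → i < j → j < k → k < N → f i < f k → f k < f j → ⊥)
  (no213 : ∀ {i j k} → i < j → j < k → k < N → f j < f i → f i < f k → ⊥)
  where

  open import Data.Nat
  open import Data.Nat.Properties
  open import Data.Bool using (true; false; not; _∧_; _xor_)
  open import Data.Bool.Properties using (T-≡; ∧-zeroʳ; ∧-identityʳ; xor-identityʳ)
  open import Function.Bundles using (Equivalence)
  open import Data.Product using (_×_; _,_; ∃-syntax; proj₁; proj₂)
  open import Data.Sum using (_⊎_; inj₁; inj₂)
  open import Data.Empty using (⊥; ⊥-elim)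
  open import Relation.Binary.PropositionalEquality
  open import Relation.Nullary using (yes; no)
  open import Relation.Binary.Definitions using (tri<; tri≈; tri>)
  open import Data.Nat.Tactic.RingSolver using (solve-∀)
  open BoundedSearch
  open Parity

  open Shape N f public
  open Iteration N f bound inj

  start⇒descent : ∀ x → startsBlock (suc x) ≡ true → suc x < N × f (suc x) < f x
  start⇒descent x eq with suc x <ᵇ N in e1 | f (suc x) <ᵇ f x in e2
  start⇒descent x refl | true | true =
    <ᵇ⇒< (suc x) N (Equivalence.from T-≡ e1) , <ᵇ⇒< (f (suc x)) (f x) (Equivalence.from T-≡ e2)

  descent⇒start : ∀ x → suc x < N → f (suc x) < f x → startsBlock (suc x) ≡ true
  descent⇒start x p q rewrite Equivalence.to T-≡ (<⇒<ᵇ p) | Equivalence.to T-≡ (<⇒<ᵇ q) = refl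

  nonstart⇒ascent : ∀ x → suc x < N → startsBlock (suc x) ≡ false → f x < f (suc x)
  nonstart⇒ascent x p eq with <-cmp (f x) (f (suc x))
  ... | tri< a _ _ = a
  ... | tri≈ _ b _ = ⊥-elim (<-irrefl refl (subst (_< suc x) (inj (<⇒≤ p) p b) ≤-refl))
  ... | tri> _ _ c with trans (sym eq) (descent⇒start x p c)
  ...   | ()

  -- Every ascent is by exactly one: the value f x + 1 can sit neither before x
  -- (a 213) nor after x + 1 (a 132).
  ascent-by-one : ∀ x → suc x < N → f x < f (suc x) → f (suc x) ≡ suc (f x)
  ascent-by-one x sx<N fx< with m≤n⇒m<n∨m≡n fx<
  ... | inj₂ e = sym e
  ... | inj₁ lt with surj (<-trans lt (bound sx<N))
  ...   | j , j<N , fj with <-cmp j x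
  ...     | tri< j<x _ _ = ⊥-elim (no213 j<x (n<1+n x) sx<N (subst (f x <_) (sym fj) (n<1+n (f x)))
                                           (subst (_< f (suc x)) (sym fj) lt))
  ...     | tri≈ _ refl _ = ⊥-elim (<-irrefl fj (n<1+n (f x)))
  ...     | tri> _ _ x<j with <-cmp j (suc x)
  ...       | tri< j<sx _ _ = ⊥-elim (<-irrefl refl (<-≤-trans x<j (≤-pred j<sx)))
  ...       | tri≈ _ refl _ = ⊥-elim (<-irrefl (sym fj) lt)
  ...       | tri> _ _ sx<j = ⊥-elim (no132 (n<1+n x) sx<j j<N (subst (f x <_) (sym fj) (n<1+n (f x)))
                                             (subst (_< f (suc x)) (sym fj) lt))

  rising-run : ∀ i d → i + d < N → f i ≤ f (i + d) →
               (f (i + d) ≡ f i + d) × (∀ j → i < j → j ≤ i + d → startsBlock j ≡ false)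
  rising-run i zero p q =
    trans (cong f (+-identityʳ i)) (sym (+-identityʳ (f i))) ,
    λ j a b → ⊥-elim (<-irrefl refl (<-≤-trans a (subst (j ≤_) (+-identityʳ i) b)))
  rising-run i (suc d) p q rewrite +-suc i d = extend
    where
    k = i + d
    i≤k = m≤m+n i d
    fi<fsk : f i < f (suc k)
    fi<fsk = ≤∧≢⇒< q (λ e → <-irrefl (inj (≤-<-trans i≤k (<-trans (n<1+n k) p)) p e) (s≤s i≤k))
    i<k : f i ≢ f k → i < k
    i<k ne = ≤∧≢⇒< i≤k (λ e → ne (cong f e))
    extend : (f (suc k) ≡ f i + suc d) × (∀ j → i < j → j ≤ suc k → startsBlock j ≡ false)
    extend with f i ≤? f k
    ... | no fi≰fk = ⊥-elim (no213 (i<k (λ e → fi≰fk (≤-reflexive e))) (n<1+n k) p (≰⇒> fi≰fk) fi<fsk)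
    ... | yes fi≤fk with rising-run i d (<-trans (n<1+n _) p) fi≤fk | <-cmp (f k) (f (suc k))
    ...   | run , inside | tri< lt _ _ =
            trans (ascent-by-one k p lt) (trans (cong suc run) (sym (+-suc (f i) d))) , inside′
      where
      inside′ : ∀ j → i < j → j ≤ suc k → startsBlock j ≡ false
      inside′ j a b with m≤n⇒m<n∨m≡n b
      ... | inj₁ j<sk = inside j a (≤-pred j<sk)
      ... | inj₂ refl with startsBlock (suc k) in e
      ...   | false = refl
      ...   | true = ⊥-elim (<-asym lt (proj₂ (start⇒descent k e)))
    ...   | _ | tri≈ _ e _ = ⊥-elim (<-irrefl (inj (<-trans (n<1+n _) p) p e) (n<1+n k))
    ...   | _ | tri> _ _ gt =
            ⊥-elim (no132 (i<k (λ e → <-irrefl e (<-trans fi<fsk gt))) (n<1+n k) p fi<fsk gt)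

  below-after-start : ∀ i j k → i < j → j ≤ k → k < N → startsBlock j ≡ true → f k < f i
  below-after-start i j k i<j j≤k k<N start with f i ≤? f k
  ... | no fi≰fk = ≰⇒> fi≰fk
  ... | yes fi≤fk = ⊥-elim (true≢false (trans (sym start) (proj₂ run j i<j (subst (j ≤_) (sym k≡) j≤k))))
    where
    k≡ : i + (k ∸ i) ≡ k
    k≡ = m+[n∸m]≡n (<⇒≤ (<-≤-trans i<j j≤k))
    run = rising-run i (k ∸ i) (subst (_< N) (sym k≡) k<N) (subst (λ z → f i ≤ f z) (sym k≡) fi≤fk)
    true≢false : true ≢ false
    true≢false ()

  run-values : ∀ i d → i + d < N → (∀ j → i < j → j ≤ i + d → startsBlock j ≡ false) →
               f (i + d) ≡ f i + d
  run-values i zero p h = trans (cong f (+-identityʳ i)) (sym (+-identityʳ (f i)))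
  run-values i (suc d) p h rewrite +-suc i d =
    trans (ascent-by-one (i + d) p (nonstart⇒ascent (i + d) p (h (suc (i + d)) (s≤s (m≤m+n i d)) ≤-refl)))
          (trans (cong suc (run-values i d (<-trans (n<1+n _) p) (λ j a b → h j a (m≤n⇒m≤1+n b))))
                 (sym (+-suc (f i) d)))

  run-offset : ∀ i k → i ≤ k → k < N → (∀ j → i < j → j ≤ k → startsBlock j ≡ false) →
               f k + i ≡ f i + k
  run-offset i k i≤k k<N h =
    begin
      f k + i              ≡⟨ cong (λ z → f z + i) (sym k≡) ⟩
      f (i + d) + i        ≡⟨ cong (_+ i) (run-values i d (subst (_< N) (sym k≡) k<N)
                                                      (λ j a b → h j a (subst (j ≤_) k≡ b))) ⟩
      f i + d + i          ≡⟨ +-assoc (f i) d i ⟩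
      f i + (d + i)        ≡⟨ cong (f i +_) (m∸n+n≡m i≤k) ⟩
      f i + k ∎
    where
    open ≡-Reasoning
    d = k ∸ i
    k≡ : i + d ≡ k
    k≡ = m+[n∸m]≡n i≤k

  run-monotone : ∀ i k → i ≤ k → k < N → (∀ j → i < j → j ≤ k → startsBlock j ≡ false) → f i ≤ f k
  run-monotone i k i≤k k<N h =
    +-cancelʳ-≤ i (f i) (f k) (subst (f i + i ≤_) (sym (run-offset i k i≤k k<N h)) (+-monoʳ-≤ (f i) i≤k))

  IsStart : ℕ → Set
  IsStart s = s ≡ 0 ⊎ startsBlock s ≡ true

  IsEnd : ℕ → Set
  IsEnd b = b ≡ N ⊎ startsBlock b ≡ true

  private
    search-range : ∀ x → x < N → suc x + (N ∸ suc x) ≡ N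
    search-range x x<N = m+[n∸m]≡n x<N

  blockEnd-> : ∀ x → x < blockEnd x
  blockEnd-> x = firstHit-≥ startsBlock (N ∸ suc x) (suc x)

  blockEnd-≤ : ∀ x → x < N → blockEnd x ≤ N
  blockEnd-≤ x x<N = subst (blockEnd x ≤_) (search-range x x<N) (firstHit-≤ startsBlock (N ∸ suc x) (suc x))

  blockEnd-isEnd : ∀ x → x < N → IsEnd (blockEnd x)
  blockEnd-isEnd x x<N with firstHit-hit startsBlock (N ∸ suc x) (suc x)
  ... | inj₁ e = inj₁ (trans e (search-range x x<N))
  ... | inj₂ e = inj₂ e

  blockEnd-gap : ∀ x j → x < j → j < blockEnd x → startsBlock j ≡ false
  blockEnd-gap x j a b = firstHit-gap startsBlock (N ∸ suc x) (suc x) j a b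

  blockEnd-here : ∀ x → suc x < N → startsBlock (suc x) ≡ true → blockEnd x ≡ suc x
  blockEnd-here x p e rewrite +-∸-assoc 1 p | e = refl

  blockEnd-miss : ∀ x → suc x < N → startsBlock (suc x) ≡ false → blockEnd x ≡ blockEnd (suc x)
  blockEnd-miss x p e rewrite +-∸-assoc 1 p | e = refl

  blockEnd-cong : ∀ c' x → x < N → (∀ s → s < N → startsBlock s ≡ c' s) →
                  blockEnd x ≡ firstHit c' (N ∸ suc x) (suc x)
  blockEnd-cong c' x p h =
    firstHit-cong startsBlock c' (N ∸ suc x) (suc x) (λ s _ b → h s (subst (s <_) (search-range x p) b))

  SplitsAt : ℕ → Set
  SplitsAt s = ∀ j → j < N → (j < s → N ≤ f j + s) × (s ≤ j → f j + s < N)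

  block-top : ∀ a b' → SplitsAt a → a ≤ b' → b' < N → IsEnd (suc b') →
              (∀ j → a < j → j ≤ b' → startsBlock j ≡ false) → f b' + suc a ≡ N
  block-top a b' split a≤b' b'<N end inside = ≤-antisym upper lower
    where
    w = N ∸ suc a
    w+sa : w + suc a ≡ N
    w+sa = m∸n+n≡m (≤-<-trans a≤b' b'<N)
    w<N : w < N
    w<N = subst (w <_) w+sa (subst (_≤ w + suc a) (+-comm w 1) (+-monoʳ-≤ w (s≤s z≤n)))
    upper : f b' + suc a ≤ N
    upper = subst (_≤ N) (sym (+-suc (f b') a)) (proj₂ (split b' b'<N) a≤b')
    -- the value w = N - 1 - a sits in [a, b'], hence below f b'
    w≤ : w ≤ f b'
    w≤ with surj w<N
    ... | j , j<N , fj with a ≤? j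
    ...   | no a≰j = ⊥-elim (<-irrefl refl (<-≤-trans lt (proj₁ (split j j<N) (≰⇒> a≰j))))
      where
      lt : f j + a < N
      lt = subst (_≤ N) (trans (+-suc w a) (cong suc (cong (_+ a) (sym fj)))) (≤-reflexive w+sa)
    ...   | yes a≤j with j ≤? b'
    ...     | yes j≤b' = subst (_≤ f b') fj (run-monotone j b' j≤b' b'<N (λ k x y → inside k (≤-<-trans a≤j x) y))
    ...     | no j≰b' = after end
      where
      after : IsEnd (suc b') → w ≤ f b'
      after (inj₁ e) = ⊥-elim (<-irrefl refl (<-≤-trans j<N (subst (_≤ j) e (≰⇒> j≰b'))))
      after (inj₂ c) = <⇒≤ (subst (_< f b') fj (below-after-start b' (suc b') j ≤-refl (≰⇒> j≰b') j<N c))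
    lower : N ≤ f b' + suc a
    lower = subst (_≤ f b' + suc a) w+sa (+-monoˡ-≤ (suc a) w≤)

  -- Every block start splits the values; by induction over the block starts
  -- (the fuel m bounds s).
  splitsAt-start : ∀ s → s < N → IsStart s → SplitsAt s
  splitsAt-start s = go s s ≤-refl
    where
    go : ∀ m s → s ≤ m → s < N → IsStart s → SplitsAt s
    go m zero _ _ _ j j<N = (λ ()) , λ _ → subst (_< N) (sym (+-identityʳ (f j))) (bound j<N)
    go zero (suc s) () _ _
    go (suc m) (suc s) s≤m s<N st with m≤n⇒m<n∨m≡n s≤m
    ... | inj₁ lt = go m (suc s) (≤-pred lt) s<N st
    ... | inj₂ refl with st
    ...   | inj₁ ()
    ...   | inj₂ cs = λ j j<N → before j j<N , from j j<N
      where
      a = blockStart s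
      a≤s : a ≤ s
      a≤s = lastHit-≤ startsBlock s
      split : SplitsAt a
      split = go s a a≤s (≤-<-trans a≤s (<-trans (n<1+n s) s<N)) (lastHit-hit startsBlock s)
      inside : ∀ j → a < j → j ≤ s → startsBlock j ≡ false
      inside = lastHit-gap startsBlock s
      top : f a + suc s ≡ N
      top = begin
        f a + suc s   ≡⟨ +-suc (f a) s ⟩
        suc (f a + s) ≡⟨ cong suc (sym (run-offset a s a≤s (<-trans (n<1+n s) s<N) inside)) ⟩
        suc (f s + a) ≡⟨ sym (+-suc (f s) a) ⟩
        f s + suc a   ≡⟨ block-top a s split a≤s (<-trans (n<1+n s) s<N) (inj₂ cs) inside ⟩
        N ∎
        where open ≡-Reasoning
      before : ∀ j → j < N → j < suc s → N ≤ f j + suc s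
      before j j<N j<ss with a ≤? j
      ... | no a≰j = ≤-trans (proj₁ (split j j<N) (≰⇒> a≰j)) (+-monoʳ-≤ (f j) (m≤n⇒m≤1+n a≤s))
      ... | yes a≤j = subst (_≤ f j + suc s) top
                        (+-monoˡ-≤ (suc s) (run-monotone a j a≤j j<N (λ k x y → inside k x (≤-trans y (≤-pred j<ss)))))
      from : ∀ j → j < N → suc s ≤ j → f j + suc s < N
      from j j<N ss≤j = subst (f j + suc s <_) top (+-monoˡ-< (suc s) (below-after-start a (suc s) j (s≤s a≤s) ss≤j j<N cs))

  block-value-within : ∀ a j b' → a < N → IsStart a → a ≤ j → j ≤ b' → b' < N → IsEnd (suc b') →
                       (∀ k → a < k → k ≤ b' → startsBlock k ≡ false) → f j + a + suc b' ≡ N + j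
  block-value-within a j b' a<N st a≤j j≤b' b'<N end inside =
    begin
      f j + a + suc b'   ≡⟨ cong (_+ suc b') (run-offset a j a≤j (≤-<-trans j≤b' b'<N) (λ k x y → inside k x (≤-trans y j≤b'))) ⟩
      f a + j + suc b'   ≡⟨ shift₁ (f a) j b' ⟩
      (f a + b') + suc j ≡⟨ cong (_+ suc j) (sym (run-offset a b' (≤-trans a≤j j≤b') b'<N inside)) ⟩
      (f b' + a) + suc j ≡⟨ shift₂ (f b') a j ⟩
      (f b' + suc a) + j ≡⟨ cong (_+ j) (block-top a b' (splitsAt-start a a<N st) (≤-trans a≤j j≤b') b'<N end inside) ⟩
      N + j ∎
    where
    open ≡-Reasoning
    shift₁ : ∀ x j b → x + j + suc b ≡ x + b + suc j
    shift₁ = solve-∀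
    shift₂ : ∀ x a j → x + a + suc j ≡ x + suc a + j
    shift₂ = solve-∀

  block-value : ∀ x y → x < N → blockStart x ≤ y → y < blockEnd x →
                f y + blockStart x + blockEnd x ≡ N + y
  block-value x y x<N a≤y y<b = go (blockEnd x) refl y<b (blockEnd-≤ x x<N) (blockEnd-isEnd x x<N)
    where
    go : ∀ b → b ≡ blockEnd x → y < b → b ≤ N → IsEnd b → f y + blockStart x + b ≡ N + y
    go (suc b') e y<b b≤N end =
      block-value-within (blockStart x) y b' (≤-<-trans (lastHit-≤ startsBlock x) x<N) (lastHit-hit startsBlock x)
                         a≤y (≤-pred y<b) b≤N end inside
      where
      inside : ∀ k → blockStart x < k → k ≤ b' → startsBlock k ≡ false
      inside k p q with k ≤? x
      ... | yes k≤x = lastHit-gap startsBlock x k p k≤x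
      ... | no k≰x = blockEnd-gap x k (≰⇒> k≰x) (subst (k <_) e (s≤s q))

  block-formula : ∀ x → x < N → f x + blockStart x + blockEnd x ≡ N + x
  block-formula x x<N = block-value x x x<N (lastHit-≤ startsBlock x) (blockEnd-> x)

  -- ρ is an involution, in the form: y = ρ i implies ρ y = i.
  ρ-involutive : ∀ i y → i < N → y + suc (f i) ≡ N → f y + suc i ≡ N
  ρ-involutive i y i<N y≡ =
    +-cancelʳ-≡ y _ _ (begin
      f y + suc i + y    ≡⟨ regroup (f y) (suc i) y ⟩
      f y + (y + suc i)  ≡⟨ cong (f y +_) y+si ⟩
      f y + (a + b)      ≡⟨ sym (+-assoc (f y) a b) ⟩
      f y + a + b        ≡⟨ block-value i y i<N a≤y y<b ⟩
      N + y ∎)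
    where
    open ≡-Reasoning
    a = blockStart i
    b = blockEnd i
    regroup : ∀ fy si y → fy + si + y ≡ fy + (y + si)
    regroup = solve-∀
    swap : ∀ x y i → x + (y + suc i) ≡ (y + suc x) + i
    swap = solve-∀
    -- y is the reflection of i in its block: y + i + 1 = a + b
    y+si : y + suc i ≡ a + b
    y+si = +-cancelˡ-≡ (f i) _ _ (begin
        f i + (y + suc i)    ≡⟨ swap (f i) y i ⟩
        (y + suc (f i)) + i  ≡⟨ cong (_+ i) y≡ ⟩
        N + i                ≡⟨ sym (block-formula i i<N) ⟩
        f i + a + b          ≡⟨ +-assoc (f i) a b ⟩
        f i + (a + b) ∎)
    a≤y : a ≤ y
    a≤y = +-cancelʳ-≤ b a y (subst (_≤ y + b) y+si (+-monoʳ-≤ y (blockEnd-> i)))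
    y<b : y < b
    y<b = +-cancelʳ-≤ i (suc y) b
            (subst (_≤ b + i) (+-suc y i)
              (subst (y + suc i ≤_) (+-comm i b) (subst (_≤ i + b) (sym y+si) (+-monoˡ-≤ b (lastHit-≤ startsBlock i)))))

  isFixed-true : ∀ x → f x + suc x ≡ N → isFixed x ≡ true
  isFixed-true x e = Equivalence.to T-≡ (≡⇒≡ᵇ _ _ e)

  isFixed-sound : ∀ x → isFixed x ≡ true → f x + suc x ≡ N
  isFixed-sound x e = ≡ᵇ⇒≡ _ _ (Equivalence.from T-≡ e)

  isFixed-false : ∀ x → f x + suc x ≢ N → isFixed x ≡ false
  isFixed-false x not-fixed with isFixed x in eq
  ... | true = ⊥-elim (not-fixed (isFixed-sound x eq))
  ... | false = refl

  fixed⇒midpoint : ∀ x → x < N → f x + suc x ≡ N → blockStart x + blockEnd x ≡ suc (x + x)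
  fixed⇒midpoint x x<N e = +-cancelˡ-≡ (f x) _ _ (begin
      f x + (blockStart x + blockEnd x) ≡⟨ sym (+-assoc (f x) (blockStart x) (blockEnd x)) ⟩
      f x + blockStart x + blockEnd x   ≡⟨ block-formula x x<N ⟩
      N + x                             ≡⟨ cong (_+ x) (sym e) ⟩
      f x + suc x + x                   ≡⟨ +-assoc (f x) (suc x) x ⟩
      f x + suc (x + x) ∎)
    where open ≡-Reasoning

  midpoint⇒fixed : ∀ x → x < N → blockStart x + blockEnd x ≡ suc (x + x) → f x + suc x ≡ N
  midpoint⇒fixed x x<N e = +-cancelʳ-≡ x _ _ (begin
      f x + suc x + x                   ≡⟨ +-assoc (f x) (suc x) x ⟩
      f x + suc (x + x)                 ≡⟨ cong (f x +_) (sym e) ⟩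
      f x + (blockStart x + blockEnd x) ≡⟨ sym (+-assoc (f x) (blockStart x) (blockEnd x)) ⟩
      f x + blockStart x + blockEnd x   ≡⟨ block-formula x x<N ⟩
      N + x ∎)
    where open ≡-Reasoning

  noMidpoint : ∀ x → x + x < blockStart x + blockEnd x → oddMidpointBefore x ≡ false
  noMidpoint x lt = trans (cong (isOdd (blockStart x + blockEnd x) ∧_) (≤ᵇ-false _ _ (<⇒≱ lt))) (∧-zeroʳ _)

  noMidpoint-at-start : ∀ x → startsBlock (suc x) ≡ true → oddMidpointBefore (suc x) ≡ false
  noMidpoint-at-start x e = noMidpoint (suc x)
    (subst (λ a → suc x + suc x < a + blockEnd (suc x)) (sym (lastHit-here startsBlock x e))
           (+-monoʳ-< (suc x) (blockEnd-> (suc x))))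

  -- Parity invariant: the number of fixed points before x has the parity of
  -- the start of x's block, corrected by one once x is past the midpoint of an
  -- odd block.
  Invariant : ℕ → Set
  Invariant x = isOdd (fixedBelow x) ≡ isOdd (blockStart x) xor oddMidpointBefore x

  start-parity : ∀ x → startsBlock (suc x) ≡ true →
                 isOdd (blockStart (suc x)) xor oddMidpointBefore (suc x) ≡ isOdd (suc x)
  start-parity x e = trans (cong₂ (λ s m → isOdd s xor m) (lastHit-here startsBlock x e) (noMidpoint-at-start x e))
                           (xor-identityʳ _)

  invariant-step-start : ∀ x → suc x < N → startsBlock (suc x) ≡ true → Invariant x → Invariant (suc x)
  invariant-step-start x p e inv with m≤n⇒m<n∨m≡n (lastHit-≤ startsBlock x)
  ... | inj₂ a≡x = begin
      isOdd (fixedBelow x + indicator (isFixed x)) ≡⟨ isOdd-+indicator (fixedBelow x) (isFixed x) ⟩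
      isOdd (fixedBelow x) xor isFixed x           ≡⟨ cong₂ _xor_ inv (isFixed-true x (midpoint⇒fixed x x<N a+b)) ⟩
      (isOdd a xor oddMidpointBefore x) xor true   ≡⟨ cong (λ m → (isOdd a xor m) xor true)
                                                           (noMidpoint x (subst (x + x <_) (sym a+b) (n<1+n _))) ⟩
      (isOdd a xor false) xor true                 ≡⟨ cong (λ z → (isOdd z xor false) xor true) a≡x ⟩
      (isOdd x xor false) xor true                 ≡⟨ cong (_xor true) (xor-identityʳ (isOdd x)) ⟩
      isOdd x xor true                             ≡⟨ xor-true (isOdd x) ⟩
      isOdd (suc x)                                ≡⟨ sym (start-parity x e) ⟩
      isOdd (blockStart (suc x)) xor oddMidpointBefore (suc x) ∎
    where
    open ≡-Reasoning
    x<N = <-trans (n<1+n x) p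
    a = blockStart x
    -- x forms a block of its own
    a+b : a + blockEnd x ≡ suc (x + x)
    a+b = trans (cong₂ _+_ a≡x (blockEnd-here x p e)) (+-suc x x)
  ... | inj₁ a<x = begin
      isOdd (fixedBelow x + indicator (isFixed x)) ≡⟨ isOdd-+indicator (fixedBelow x) (isFixed x) ⟩
      isOdd (fixedBelow x) xor isFixed x           ≡⟨ cong₂ _xor_ inv (isFixed-false x notFixed) ⟩
      (isOdd a xor oddMidpointBefore x) xor false  ≡⟨ xor-identityʳ _ ⟩
      isOdd a xor oddMidpointBefore x              ≡⟨ cong (isOdd a xor_) passed ⟩
      isOdd a xor isOdd (a + suc x)                ≡⟨ cong (isOdd a xor_) (isOdd-+ a (suc x)) ⟩
      isOdd a xor (isOdd a xor isOdd (suc x))      ≡⟨ xor-cancelˡ (isOdd a) (isOdd (suc x)) ⟩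
      isOdd (suc x)                                ≡⟨ sym (start-parity x e) ⟩
      isOdd (blockStart (suc x)) xor oddMidpointBefore (suc x) ∎
    where
    open ≡-Reasoning
    x<N = <-trans (n<1+n x) p
    a = blockStart x
    b≡ : blockEnd x ≡ suc x
    b≡ = blockEnd-here x p e
    passed : oddMidpointBefore x ≡ isOdd (a + suc x)
    passed = trans (cong (λ b → isOdd (a + b) ∧ (a + b ≤ᵇ x + x)) b≡)
                   (trans (cong (isOdd (a + suc x) ∧_)
                                (≤ᵇ-true _ _ (subst (_≤ x + x) (sym (+-suc a x)) (+-monoˡ-≤ x a<x))))
                          (∧-identityʳ _))
    notFixed : f x + suc x ≢ N
    notFixed fixed = <-irrefl (+-cancelʳ-≡ (suc x) _ _ (trans (sym (cong (a +_) b≡))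
                                (trans (fixed⇒midpoint x x<N fixed) (sym (+-suc x x))))) a<x

  invariant-step-inside : ∀ x → suc x < N → startsBlock (suc x) ≡ false → Invariant x → Invariant (suc x)
  invariant-step-inside x p e inv with blockStart x + blockEnd x ≟ suc (x + x)
  ... | yes mid = begin
      isOdd (fixedBelow x + indicator (isFixed x)) ≡⟨ isOdd-+indicator (fixedBelow x) (isFixed x) ⟩
      isOdd (fixedBelow x) xor isFixed x           ≡⟨ cong₂ _xor_ inv (isFixed-true x (midpoint⇒fixed x x<N mid)) ⟩
      (isOdd a xor oddMidpointBefore x) xor true   ≡⟨ cong (λ m → (isOdd a xor m) xor true)
                                                           (noMidpoint x (subst (x + x <_) (sym mid) (n<1+n _))) ⟩
      (isOdd a xor false) xor true                 ≡⟨ cong (_xor true) (xor-identityʳ (isOdd a)) ⟩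
      isOdd a xor true                             ≡⟨ cong (isOdd a xor_) (sym reached) ⟩
      isOdd a xor (isOdd (a + b) ∧ (a + b ≤ᵇ suc x + suc x)) ≡⟨ sym sameBlock ⟩
      isOdd (blockStart (suc x)) xor oddMidpointBefore (suc x) ∎
    where
    open ≡-Reasoning
    x<N = <-trans (n<1+n x) p
    a = blockStart x
    b = blockEnd x
    sameBlock : isOdd (blockStart (suc x)) xor oddMidpointBefore (suc x) ≡
                isOdd a xor (isOdd (a + b) ∧ (a + b ≤ᵇ suc x + suc x))
    sameBlock = cong₂ (λ s t → isOdd s xor (isOdd (s + t) ∧ (s + t ≤ᵇ suc x + suc x)))
                      (lastHit-miss startsBlock x e) (sym (blockEnd-miss x p e))
    reached : isOdd (a + b) ∧ (a + b ≤ᵇ suc x + suc x) ≡ true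
    reached = trans (cong (λ m → isOdd m ∧ (m ≤ᵇ suc x + suc x)) mid)
                    (cong₂ _∧_ (cong not (isOdd-double x))
                               (≤ᵇ-true _ _ (subst (suc (x + x) ≤_) (sym (+-suc (suc x) x)) (n≤1+n _))))
  ... | no ¬mid = begin
      isOdd (fixedBelow x + indicator (isFixed x)) ≡⟨ isOdd-+indicator (fixedBelow x) (isFixed x) ⟩
      isOdd (fixedBelow x) xor isFixed x           ≡⟨ cong₂ _xor_ inv (isFixed-false x (λ fixed → ¬mid (fixed⇒midpoint x x<N fixed))) ⟩
      (isOdd a xor oddMidpointBefore x) xor false  ≡⟨ xor-identityʳ _ ⟩
      isOdd a xor oddMidpointBefore x              ≡⟨ cong (isOdd a xor_) (odd-below-step (a + b) x ¬mid) ⟩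
      isOdd a xor (isOdd (a + b) ∧ (a + b ≤ᵇ suc x + suc x)) ≡⟨ sym sameBlock ⟩
      isOdd (blockStart (suc x)) xor oddMidpointBefore (suc x) ∎
    where
    open ≡-Reasoning
    x<N = <-trans (n<1+n x) p
    a = blockStart x
    b = blockEnd x
    sameBlock : isOdd (blockStart (suc x)) xor oddMidpointBefore (suc x) ≡
                isOdd a xor (isOdd (a + b) ∧ (a + b ≤ᵇ suc x + suc x))
    sameBlock = cong₂ (λ s t → isOdd s xor (isOdd (s + t) ∧ (s + t ≤ᵇ suc x + suc x)))
                      (lastHit-miss startsBlock x e) (sym (blockEnd-miss x p e))

  invariant : ∀ x → x < N → Invariant x
  invariant zero _ = sym (noMidpoint zero (blockEnd-> zero))
  invariant (suc x) p = step (startsBlock (suc x)) refl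
    where
    step : ∀ c → startsBlock (suc x) ≡ c → Invariant (suc x)
    step true e = invariant-step-start x p e (invariant x (<-trans (n<1+n x) p))
    step false e = invariant-step-inside x p e (invariant x (<-trans (n<1+n x) p))

  fixedBelow-at-start : ∀ s → s < N → startsBlock s ≡ true → isOdd (fixedBelow s) ≡ isOdd s
  fixedBelow-at-start zero _ ()
  fixedBelow-at-start (suc x) p e = trans (invariant (suc x) p) (start-parity x e)

  fixed-start⇒next-start : ∀ c → suc c < N → f c + suc c ≡ N → startsBlock c ≡ true →
                           startsBlock (suc c) ≡ true
  fixed-start⇒next-start zero _ _ ()
  fixed-start⇒next-start (suc c) p fixed e = atEnd (blockEnd-isEnd (suc c) (<-trans (n<1+n _) p))
    where
    singletonEnd : blockEnd (suc c) ≡ suc (suc c)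
    singletonEnd = +-cancelˡ-≡ (suc c) _ _
      (trans (cong (_+ blockEnd (suc c)) (sym (lastHit-here startsBlock c e)))
             (trans (fixed⇒midpoint (suc c) (<-trans (n<1+n _) p) fixed) (sym (+-suc (suc c) (suc c)))))
    atEnd : IsEnd (blockEnd (suc c)) → startsBlock (suc (suc c)) ≡ true
    atEnd (inj₁ b≡N) = ⊥-elim (<-irrefl (trans (sym singletonEnd) b≡N) p)
    atEnd (inj₂ start) = subst (λ z → startsBlock z ≡ true) singletonEnd start

  fixed-next-start⇒start : ∀ c → 0 < c → suc c < N → f c + suc c ≡ N → startsBlock (suc c) ≡ true →
                           startsBlock c ≡ true
  fixed-next-start⇒start c 0<c p fixed e = atStart (lastHit-hit startsBlock c)
    where
    singletonStart : blockStart c ≡ c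
    singletonStart = +-cancelʳ-≡ (suc c) _ _
      (trans (cong (blockStart c +_) (sym (blockEnd-here c p e)))
             (trans (fixed⇒midpoint c (<-trans (n<1+n _) p) fixed) (sym (+-suc c c))))
    atStart : IsStart (blockStart c) → startsBlock c ≡ true
    atStart (inj₁ a≡0) = ⊥-elim (<-irrefl (trans (sym a≡0) singletonStart) 0<c)
    atStart (inj₂ start) = subst (λ z → startsBlock z ≡ true) singletonStart start

  fixedBelow-witness : ∀ x k → suc k ≤ fixedBelow x → ∃[ c ] (c < x × isFixed c ≡ true × k ≤ fixedBelow c)
  fixedBelow-witness zero k ()
  fixedBelow-witness (suc x) k le with isFixed x in e
  ... | true = x , n<1+n x , e , ≤-pred (subst (suc k ≤_) (+-comm (fixedBelow x) 1) le)
  ... | false with fixedBelow-witness x k (subst (suc k ≤_) (+-identityʳ (fixedBelow x)) le)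
  ...   | c , c<x , fixed , k≤ = c , <-trans c<x (n<1+n x) , fixed , k≤

  ρ-sum : ∀ {x} → x < N → ρ x + suc (f x) ≡ N
  ρ-sum p = m∸n+n≡m (bound p)

  fixed⇒ρ-fixed : ∀ {c} → f c + suc c ≡ N → ρ c ≡ c
  fixed⇒ρ-fixed {c} e = trans (cong (_∸ suc (f c)) (sym c+ρ)) (m+n∸n≡m c (suc (f c)))
    where
    c+ρ : c + suc (f c) ≡ N
    c+ρ = trans (+-suc c (f c)) (trans (cong suc (+-comm c (f c))) (trans (sym (+-suc (f c) c)) e))

  -- ρ conjugates f into its inverse: f ∘ ρ ∘ f = ρ, hence f^k ∘ ρ ∘ f^k = ρ.
  f-ρ-f : ∀ {x} → x < N → f (ρ (f x)) ≡ ρ x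
  f-ρ-f {x} p = +-cancelʳ-≡ (suc (f x)) _ _
    (trans (ρ-involutive (f x) (ρ (f x)) (bound p) (ρ-sum (bound p))) (sym (ρ-sum p)))

  iterate-ρ-iterate : ∀ k {x} → x < N → iterate k (ρ (iterate k x)) ≡ ρ x
  iterate-ρ-iterate zero p = refl
  iterate-ρ-iterate (suc k) {x} p = begin
      iterate (suc k) (ρ (f (iterate k x))) ≡⟨ iterate-comm 1 k (ρ (f (iterate k x))) ⟩
      iterate k (f (ρ (f (iterate k x))))   ≡⟨ cong (iterate k) (f-ρ-f (iterate-< k p)) ⟩
      iterate k (ρ (iterate k x))           ≡⟨ iterate-ρ-iterate k p ⟩
      ρ x ∎
    where open ≡-Reasoning

  module Cyclic (N>0 : 0 < N) (cyc : ∀ m → 0 < m → m < N → iterate m 0 ≢ 0) where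

    open NCycle N>0 cyc

    two-fixed-points : ∀ {c d} → c < N → d < N → f c + suc c ≡ N → f d + suc d ≡ N → c ≢ d →
                       ∃[ k ] (k + k ≡ N × iterate k c ≡ d)
    two-fixed-points {c} {d} p q c-fixed d-fixed c≢d with reach p q
    ... | k , k<N , c↦d = k , return-time p (positive k c↦d) (+-mono-< k<N k<N) back , c↦d
      where
      open ≡-Reasoning
      d↦c : iterate k d ≡ c
      d↦c = begin
        iterate k d                  ≡⟨ cong (iterate k) (sym (fixed⇒ρ-fixed d-fixed)) ⟩
        iterate k (ρ d)              ≡⟨ cong (λ z → iterate k (ρ z)) (sym c↦d) ⟩
        iterate k (ρ (iterate k c))  ≡⟨ iterate-ρ-iterate k p ⟩
        ρ c                          ≡⟨ fixed⇒ρ-fixed c-fixed ⟩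
        c ∎
      back : iterate (k + k) c ≡ c
      back = trans (iterate-+ k k c) (trans (cong (iterate k) c↦d) d↦c)
      positive : ∀ k → iterate k c ≡ d → 0 < k + k
      positive zero c≡d = ⊥-elim (c≢d c≡d)
      positive (suc k) _ = z<s

    three-fixed-points : ∀ {c d e} → c < d → d < e → e < N →
                         isFixed c ≡ true → isFixed d ≡ true → isFixed e ≡ true → ⊥
    three-fixed-points {c} {d} {e} c<d d<e e<N c-fixed d-fixed e-fixed
      with two-fixed-points (<-trans c<d (<-trans d<e e<N)) (<-trans d<e e<N)
                            (isFixed-sound c c-fixed) (isFixed-sound d d-fixed) (<⇒≢ c<d)
         | two-fixed-points (<-trans c<d (<-trans d<e e<N)) e<N
                            (isFixed-sound c c-fixed) (isFixed-sound e e-fixed) (<⇒≢ (<-trans c<d d<e))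
    ... | k₁ , 2k₁≡N , c↦d | k₂ , 2k₂≡N , c↦e =
      <⇒≢ d<e (trans (sym c↦d) (trans (cong (λ k → iterate k c) k₁≡k₂) c↦e))
      where
      k₁≡k₂ : k₁ ≡ k₂
      k₁≡k₂ = trans (n≡⌊n+n/2⌋ k₁) (trans (cong ⌊_/2⌋ (trans 2k₁≡N (sym 2k₂≡N))) (sym (n≡⌊n+n/2⌋ k₂)))

    fixedBelow-≤2 : ∀ x → x ≤ N → fixedBelow x ≤ 2
    fixedBelow-≤2 x x≤N with 3 ≤? fixedBelow x
    ... | no 3≰ = ≤-pred (≰⇒> 3≰)
    ... | yes 3≤ with fixedBelow-witness x 2 3≤
    ...   | c₃ , c₃<x , f₃ , 2≤ with fixedBelow-witness c₃ 1 2≤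
    ...     | c₂ , c₂<c₃ , f₂ , 1≤ with fixedBelow-witness c₂ 0 1≤
    ...       | c₁ , c₁<c₂ , f₁ , _ = ⊥-elim (three-fixed-points c₁<c₂ c₂<c₃ (<-≤-trans c₃<x x≤N) f₁ f₂ f₃)

module ListCounting where

  open import Data.Nat
  open import Data.Nat.Properties
  open import Data.Fin using (Fin)
  open import Data.Vec using (Vec; []; _∷_)
  open import Data.Vec.Properties using (∷-injectiveˡ; ∷-injectiveʳ)
  open import Data.List using (List; []; _∷_; length; map; _++_; concatMap; allFin; cartesianProduct)
  open import Data.List.Properties using (length-++; length-map)
  open import Data.List.Membership.Propositional using (_∈_)
  open import Data.List.Membership.Propositional.Properties using (∈-∃++; ∈-++⁻; ∈-++⁺ˡ; ∈-++⁺ʳ; ∈-map⁻)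
  open import Data.List.Relation.Unary.Any using (here; there)
  open import Data.List.Relation.Unary.All using (All; []; _∷_)
  import Data.List.Relation.Unary.All as All
  open import Data.List.Relation.Unary.AllPairs using ([]; _∷_)
  import Data.List.Relation.Unary.AllPairs as AllPairs
  import Data.List.Relation.Unary.AllPairs.Properties as AllPairs
  open import Data.List.Relation.Unary.Unique.Propositional using (Unique)
  import Data.List.Relation.Unary.Unique.Propositional.Properties as Unique
  open import Data.Bool using (Bool; true; false)
  open import Data.Product using (_×_; _,_)
  open import Data.Sum using (inj₁; inj₂)
  open import Data.Empty using (⊥-elim)
  open import Relation.Binary.PropositionalEquality
  open import Relation.Nullary using (¬_)

  length-≤-injection : ∀ {A B : Set} (g : A → B) (xs : List A) (ys : List B) → Unique xs →
                       (∀ {x} → x ∈ xs → g x ∈ ys) →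
                       (∀ {x x'} → x ∈ xs → x' ∈ xs → g x ≡ g x' → x ≡ x') → length xs ≤ length ys
  length-≤-injection g [] ys _ _ _ = z≤n
  length-≤-injection g (x ∷ xs) ys (x∉xs ∷ unique) into inj with ∈-∃++ (into (here refl))
  ... | us , vs , refl = subst (suc (length xs) ≤_) (sym length-ys) (s≤s rest)
    where
    -- remove g x from ys; the images of the other elements stay
    into′ : ∀ {x'} → x' ∈ xs → g x' ∈ us ++ vs
    into′ {x'} m with ∈-++⁻ us (into (there m))
    ... | inj₁ p = ∈-++⁺ˡ p
    ... | inj₂ (here e) = ⊥-elim (All.lookup x∉xs m (inj (here refl) (there m) (sym e)))
    ... | inj₂ (there p) = ∈-++⁺ʳ us p
    rest = length-≤-injection g xs (us ++ vs) unique into′ (λ a b e → inj (there a) (there b) e)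
    length-ys : length (us ++ g x ∷ vs) ≡ suc (length (us ++ vs))
    length-ys = trans (length-++ us) (trans (+-suc (length us) (length vs)) (cong suc (sym (length-++ us))))

  allVecs-unique : ∀ {n} m → Unique (allVecs {n} m)
  allVecs-unique zero = [] ∷ []
  allVecs-unique {n} (suc m) =
    Unique.concat⁺ (extensions-unique (allVecs m)) (AllPairs.map⁺ (AllPairs.map disjoint (allVecs-unique m)))
    where
    extensions : Vec (Fin n) m → List (Vec (Fin n) (suc m))
    extensions v = map (_∷ v) (allFin n)
    extensions-unique : ∀ (vs : List (Vec (Fin n) m)) → All Unique (map extensions vs)
    extensions-unique [] = []
    extensions-unique (v ∷ vs) = Unique.map⁺ ∷-injectiveˡ (Unique.allFin⁺ n) ∷ extensions-unique vs
    disjoint : ∀ {u v} → u ≢ v → ∀ {z} → ¬ (z ∈ extensions u × z ∈ extensions v)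
    disjoint u≢v (p , q) with ∈-map⁻ (_∷ _) p | ∈-map⁻ (_∷ _) q
    ... | _ , _ , refl | _ , _ , e = u≢v (∷-injectiveʳ e)

  allBitVecs : ∀ k → List (Vec Bool k)
  allBitVecs zero = [] ∷ []
  allBitVecs (suc k) = concatMap (λ v → (true ∷ v) ∷ (false ∷ v) ∷ []) (allBitVecs k)

  length-allBitVecs : ∀ k → length (allBitVecs k) ≡ 2 ^ k
  length-allBitVecs zero = refl
  length-allBitVecs (suc k) = trans (doubles (allBitVecs k)) (cong (2 *_) (length-allBitVecs k))
    where
    doubles : ∀ (vs : List (Vec Bool k)) →
              length (concatMap (λ v → (true ∷ v) ∷ (false ∷ v) ∷ []) vs) ≡ 2 * length vs
    doubles [] = refl
    doubles (v ∷ vs) = trans (cong (λ z → suc (suc z)) (doubles vs))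
                             (cong suc (sym (+-suc (length vs) (length vs + 0))))

  allBitVecs-complete : ∀ {k} (v : Vec Bool k) → v ∈ allBitVecs k
  allBitVecs-complete [] = here refl
  allBitVecs-complete {suc k} (b ∷ v) = extend b (allBitVecs k) (allBitVecs-complete v)
    where
    extend : ∀ b vs → v ∈ vs → (b ∷ v) ∈ concatMap (λ v → (true ∷ v) ∷ (false ∷ v) ∷ []) vs
    extend true (_ ∷ _) (here refl) = here refl
    extend false (_ ∷ _) (here refl) = there (here refl)
    extend b (_ ∷ vs) (there p) = there (there (extend b vs p))

  length-cartesianProduct : ∀ {A B : Set} (xs : List A) (ys : List B) →
                            length (cartesianProduct xs ys) ≡ length xs * length ys
  length-cartesianProduct [] ys = refl
  length-cartesianProduct (x ∷ xs) ys =
    trans (length-++ (map (x ,_) ys)) (cong₂ _+_ (length-map (x ,_) ys) (length-cartesianProduct xs ys))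

module Encoding where

  open import Data.Nat
  open import Data.Fin using (Fin; toℕ) renaming (zero to fzero; suc to fsuc)
  open import Data.Fin.Properties using (toℕ-injective)
  open import Data.Vec using (Vec; []; _∷_; lookup; tabulate)
  open import Data.Bool using (Bool; _∨_)
  open import Data.Product using (_×_; _,_)
  open import Relation.Binary.PropositionalEquality
  open BoundedSearch

  -- a word read as a function on ℕ (0 outside its range)
  asFunction : ∀ {n m} → Vec (Fin n) m → ℕ → ℕ
  asFunction [] _ = 0
  asFunction (x ∷ v) zero = toℕ x
  asFunction (x ∷ v) (suc i) = asFunction v i

  asFunction-lookup : ∀ {n m} (v : Vec (Fin n) m) (i : Fin m) → asFunction v (toℕ i) ≡ toℕ (lookup v i)
  asFunction-lookup (x ∷ v) fzero = refl
  asFunction-lookup (x ∷ v) (fsuc i) = asFunction-lookup v i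

  asFunction-injective : ∀ {n m} (u v : Vec (Fin n) m) →
                         (∀ x → x < m → asFunction u x ≡ asFunction v x) → u ≡ v
  asFunction-injective [] [] _ = refl
  asFunction-injective (a ∷ u) (b ∷ v) h =
    cong₂ _∷_ (toℕ-injective (h 0 z<s)) (asFunction-injective u v (λ x p → h (suc x) (s≤s p)))

  pairBit : ℕ → (ℕ → ℕ) → ℕ → Bool
  pairBit N f t = startsBlock (suc (t + t)) ∨ startsBlock (suc (suc (t + t)))
    where open Shape N f

  threshold : ℕ → (ℕ → ℕ) → ℕ → ℕ
  threshold N f ℓ = firstHit (λ x → ℓ ≤ᵇ fixedBelow (suc x)) (N ∸ 1) 0
    where open Shape N f

  threshold-< : ∀ n f ℓ → threshold (suc n) f ℓ < suc n
  threshold-< n f ℓ = s≤s (firstHit-≤ _ n 0)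

  Code : ℕ → Set
  Code N = ℕ × ℕ × Vec Bool ⌊ N /2⌋

  encode : ∀ {N} → Word N → Code N
  encode {N} π = threshold N (asFunction π) 1 , threshold N (asFunction π) 2 ,
                 tabulate (λ t → pairBit N (asFunction π) (toℕ t))

module GoodWord (n : ℕ) (π : Word (suc n)) (good : Good π) where

  open import Data.Nat
  open import Data.Nat.Properties
  open import Data.Fin using (toℕ; fromℕ<) renaming (zero to fzero; _<_ to _<ᶠ_)
  open import Data.Fin.Properties using (toℕ-fromℕ<; toℕ-injective; toℕ<n)
  open import Data.Vec using (lookup)
  open import Data.Bool using (true; not; T)
  open import Data.Unit using (tt)
  open import Data.Product using (_,_; proj₁; proj₂)
  open import Data.Sum using (inj₁; inj₂)
  open import Data.Empty using (⊥; ⊥-elim)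
  open import Relation.Binary.PropositionalEquality
  open import Relation.Nullary using (yes; no)
  open BoundedSearch
  open Parity
  open Encoding
  open FiniteInjection

  N = suc n
  f = asFunction π

  private
    perm = proj₁ good
    avoids132 = proj₁ (proj₂ good)
    avoids213 = proj₁ (proj₂ (proj₂ good))
    isCycle = proj₂ (proj₂ (proj₂ good))

    f≡lookup : ∀ {i} (p : i < N) → f i ≡ toℕ (lookup π (fromℕ< p))
    f≡lookup {i} p = trans (cong f (sym (toℕ-fromℕ< p))) (asFunction-lookup π (fromℕ< p))

    <ᶠ-fromℕ< : ∀ {a b} (pa : a < N) (pb : b < N) → a < b → fromℕ< pa <ᶠ fromℕ< pb
    <ᶠ-fromℕ< pa pb lt = subst₂ _<_ (sym (toℕ-fromℕ< pa)) (sym (toℕ-fromℕ< pb)) lt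

    <ᶠ-lookup : ∀ {a b} (pa : a < N) (pb : b < N) → f a < f b → lookup π (fromℕ< pa) <ᶠ lookup π (fromℕ< pb)
    <ᶠ-lookup pa pb lt = subst₂ _<_ (f≡lookup pa) (f≡lookup pb) lt

  bound : ∀ {i} → i < N → f i < N
  bound p = subst (_< N) (sym (f≡lookup p)) (toℕ<n _)

  inj : ∀ {i j} → i < N → j < N → f i ≡ f j → i ≡ j
  inj p q e = trans (sym (toℕ-fromℕ< p))
    (trans (cong toℕ (perm _ _ (toℕ-injective (trans (sym (f≡lookup p)) (trans e (f≡lookup q))))))
           (toℕ-fromℕ< q))

  no132 : ∀ {i j k} → i < j → j < k → k < N → f i < f k → f k < f j → ⊥
  no132 ij jk kN a b = avoids132 (fromℕ< iN , fromℕ< jN , fromℕ< kN ,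
    <ᶠ-fromℕ< iN jN ij , <ᶠ-fromℕ< jN kN jk , <ᶠ-lookup iN kN a , <ᶠ-lookup kN jN b)
    where
    jN = <-trans jk kN
    iN = <-trans ij jN

  no213 : ∀ {i j k} → i < j → j < k → k < N → f j < f i → f i < f k → ⊥
  no213 ij jk kN a b = avoids213 (fromℕ< iN , fromℕ< jN , fromℕ< kN ,
    <ᶠ-fromℕ< iN jN ij , <ᶠ-fromℕ< jN kN jk , <ᶠ-lookup jN iN a , <ᶠ-lookup iN kN b)
    where
    jN = <-trans jk kN
    iN = <-trans ij jN

  open Blocks N f bound inj (injective⇒surjective N f bound inj) no132 no213 public
  open Iteration N f bound inj using (iterate)

  iter≡iterate : ∀ k x → toℕ (iter π k x) ≡ iterate k (toℕ x)
  iter≡iterate zero x = refl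
  iter≡iterate (suc k) x = trans (sym (asFunction-lookup π (iter π k x))) (cong f (iter≡iterate k x))

  cyc : ∀ m → 0 < m → m < N → iterate m 0 ≢ 0
  cyc (suc m) _ p e = isCycle (fromℕ< (≤-pred p)) (toℕ-injective
    (trans (cong (λ z → toℕ (iter π (suc z) fzero)) (toℕ-fromℕ< (≤-pred p))) (trans (iter≡iterate (suc m) fzero) e)))

  open Cyclic z<s cyc public

  fixedBelow-mono : ∀ {x y} → x ≤ y → fixedBelow x ≤ fixedBelow y
  fixedBelow-mono {x} {y} x≤y = subst (λ z → fixedBelow x ≤ fixedBelow z) (m∸n+n≡m x≤y) (grows x (y ∸ x))
    where
    grows : ∀ x d → fixedBelow x ≤ fixedBelow (d + x)
    grows x zero = ≤-refl
    grows x (suc d) = ≤-trans (grows x d) (m≤m+n _ _)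

  threshold-spec : ∀ ℓ x → suc x < N → (ℓ ≤ᵇ fixedBelow (suc x)) ≡ (threshold N f ℓ ≤ᵇ x)
  threshold-spec ℓ x p with threshold N f ℓ ≤? x
  ... | yes le = trans (≤ᵇ-true _ _ (≤-trans (≤ᵇ⇒≤ ℓ _ (subst T (sym reached) tt)) (fixedBelow-mono (s≤s le))))
                       (sym (≤ᵇ-true _ _ le))
    where
    reached : (ℓ ≤ᵇ fixedBelow (suc (threshold N f ℓ))) ≡ true
    reached with firstHit-hit (λ y → ℓ ≤ᵇ fixedBelow (suc y)) (N ∸ 1) 0
    ... | inj₂ e = e
    ... | inj₁ e = ⊥-elim (<-irrefl refl (<-≤-trans (≤-pred p) (subst (_≤ x) e le)))
  ... | no nle = trans (firstHit-gap (λ y → ℓ ≤ᵇ fixedBelow (suc y)) (N ∸ 1) 0 x z≤n (≰⇒> nle))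
                       (sym (≤ᵇ-false _ _ nle))

  flip⇒fixed : ∀ s → isOdd (fixedBelow (suc s)) ≡ not (isOdd (fixedBelow s)) → f s + suc s ≡ N
  flip⇒fixed s e = isFixed-sound s (parity-flip (fixedBelow s) (isFixed s) e)

module Halves where

  open import Data.Nat
  open import Data.Nat.Properties
  open import Data.Product using (∃-syntax; _,_)
  open import Data.Sum using (_⊎_; inj₁; inj₂)
  open import Relation.Binary.PropositionalEquality

  half-split : ∀ x → ∃[ t ] (x ≡ t + t ⊎ x ≡ suc (t + t))
  half-split zero = 0 , inj₁ refl
  half-split (suc x) with half-split x
  ... | t , inj₁ e = t , inj₂ (cong suc e)
  ... | t , inj₂ e = suc t , inj₁ (trans (cong suc e) (cong suc (sym (+-suc t t))))

  pair-index : ∀ t M → suc (suc (t + t)) ≤ M → t < ⌊ M /2⌋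
  pair-index t M le = subst (λ z → suc z ≤ ⌊ M /2⌋) (sym (n≡⌊n+n/2⌋ t)) (⌊n/2⌋-mono le)

  halves-≤ : ∀ M → ⌊ M /2⌋ + ⌊ M /2⌋ ≤ M
  halves-≤ M = subst (⌊ M /2⌋ + ⌊ M /2⌋ ≤_) (⌊n/2⌋+⌈n/2⌉≡n M) (+-monoʳ-≤ ⌊ M /2⌋ (⌊n/2⌋≤⌈n/2⌉ M))

module StartTransfer (n : ℕ) (π π' : Word (suc n)) (g : Good π) (g' : Good π')
                     (same : Encoding.encode π ≡ Encoding.encode π') where

  open import Data.Nat
  open import Data.Nat.Properties
  open import Data.Fin using (toℕ; fromℕ<)
  open import Data.Fin.Properties using (toℕ-fromℕ<)
  open import Data.Vec using (lookup)
  open import Data.Vec.Properties using (lookup∘tabulate)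
  open import Data.Bool using (true; false; not; _∨_)
  open import Data.Bool.Properties using (∨-zeroʳ)
  open import Data.Product using (_,_; proj₁; proj₂)
  open import Data.Sum using (inj₁; inj₂)
  open import Relation.Binary.PropositionalEquality
  open Parity
  open Encoding
  open Halves

  module A = GoodWord n π g
  module B = GoodWord n π' g'
  N = suc n

  private
    ≤2-determined : ∀ a b → a ≤ 2 → b ≤ 2 → (1 ≤ᵇ a) ≡ (1 ≤ᵇ b) → (2 ≤ᵇ a) ≡ (2 ≤ᵇ b) → a ≡ b
    ≤2-determined 0 0 _ _ _ _ = refl
    ≤2-determined 1 1 _ _ _ _ = refl
    ≤2-determined 2 2 _ _ _ _ = refl
    ≤2-determined 0 1 _ _ () _
    ≤2-determined 0 2 _ _ () _
    ≤2-determined 1 0 _ _ () _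
    ≤2-determined 1 2 _ _ _ ()
    ≤2-determined 2 0 _ _ () _
    ≤2-determined 2 1 _ _ _ ()
    ≤2-determined (suc (suc (suc a))) _ (s≤s (s≤s ())) _ _ _
    ≤2-determined _ (suc (suc (suc b))) _ (s≤s (s≤s ())) _ _

  -- the counts of fixed points agree: they are at most 2 and their
  -- thresholds coincide
  fixedBelow-agree : ∀ x → suc x < N → A.fixedBelow (suc x) ≡ B.fixedBelow (suc x)
  fixedBelow-agree x p = ≤2-determined _ _ (A.fixedBelow-≤2 (suc x) (<⇒≤ p)) (B.fixedBelow-≤2 (suc x) (<⇒≤ p))
    (trans (A.threshold-spec 1 x p) (trans (cong (_≤ᵇ x) (cong proj₁ same)) (sym (B.threshold-spec 1 x p))))
    (trans (A.threshold-spec 2 x p) (trans (cong (_≤ᵇ x) (cong (λ c → proj₁ (proj₂ c)) same)) (sym (B.threshold-spec 2 x p))))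

  bit-agree : ∀ t → t < ⌊ N /2⌋ → pairBit N A.f t ≡ pairBit N B.f t
  bit-agree t p = subst (λ z → pairBit N A.f z ≡ pairBit N B.f z) (toℕ-fromℕ< p)
    (trans (sym (lookup∘tabulate (λ t → pairBit N A.f (toℕ t)) (fromℕ< p)))
      (trans (cong (λ v → lookup v (fromℕ< p)) (cong (λ c → proj₂ (proj₂ c)) same))
             (lookup∘tabulate (λ t → pairBit N B.f (toℕ t)) (fromℕ< p))))

  -- A block of π starts at the odd position s = 2t + 1.  The bit places a
  -- block start of π' at s or s + 1; in the latter case the parity of the
  -- fixed-point count flips at s, so s is a singleton block of π' anyway.
  transfer-odd : ∀ t → suc (t + t) < N → A.startsBlock (suc (t + t)) ≡ true → B.startsBlock (suc (t + t)) ≡ true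
  transfer-odd t p startA = decide (B.startsBlock s) refl
    where
    open ≡-Reasoning
    s = suc (t + t)
    bitB : (B.startsBlock s ∨ B.startsBlock (suc s)) ≡ true
    bitB = trans (sym (bit-agree t (pair-index t N p))) (cong (_∨ A.startsBlock (suc s)) startA)
    decide : ∀ b → B.startsBlock s ≡ b → B.startsBlock s ≡ true
    decide true e = e
    decide false e = B.fixed-next-start⇒start s z<s s+1<N fixed startB
      where
      startB : B.startsBlock (suc s) ≡ true
      startB = trans (sym (cong (_∨ B.startsBlock (suc s)) e)) bitB
      s+1<N : suc s < N
      s+1<N = proj₁ (B.start⇒descent s startB)
      fixed : B.f s + suc s ≡ N
      fixed = B.flip⇒fixed s (begin
        isOdd (B.fixedBelow (suc s))   ≡⟨ B.fixedBelow-at-start (suc s) s+1<N startB ⟩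
        not (isOdd s)                  ≡⟨ cong not (sym (A.fixedBelow-at-start s p startA)) ⟩
        not (isOdd (A.fixedBelow s))   ≡⟨ cong (λ z → not (isOdd z)) (fixedBelow-agree (t + t) p) ⟩
        not (isOdd (B.fixedBelow s))   ∎)

  -- A block of π starts at the even position 2t + 2 = s + 1; symmetrically, a
  -- block start of π' at s alone would make s a singleton block of π'.
  transfer-even : ∀ t → suc (suc (t + t)) < N → A.startsBlock (suc (suc (t + t))) ≡ true →
                  B.startsBlock (suc (suc (t + t))) ≡ true
  transfer-even t p startA = decide (B.startsBlock s) refl
    where
    open ≡-Reasoning
    s = suc (t + t)
    bitB : (B.startsBlock s ∨ B.startsBlock (suc s)) ≡ true
    bitB = trans (sym (bit-agree t (pair-index t N (<⇒≤ p)))) (trans (cong (A.startsBlock s ∨_) startA) (∨-zeroʳ _))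
    decide : ∀ b → B.startsBlock s ≡ b → B.startsBlock (suc s) ≡ true
    decide false e = trans (sym (cong (_∨ B.startsBlock (suc s)) e)) bitB
    decide true e = B.fixed-start⇒next-start s p fixed e
      where
      fixed : B.f s + suc s ≡ N
      fixed = B.flip⇒fixed s (begin
        isOdd (B.fixedBelow (suc s))   ≡⟨ cong isOdd (sym (fixedBelow-agree s p)) ⟩
        isOdd (A.fixedBelow (suc s))   ≡⟨ A.fixedBelow-at-start (suc s) p startA ⟩
        not (isOdd s)                  ≡⟨ cong not (sym (B.fixedBelow-at-start s (<-trans (n<1+n s) p) e)) ⟩
        not (isOdd (B.fixedBelow s))   ∎)

  transfer : ∀ s → s < N → A.startsBlock s ≡ true → B.startsBlock s ≡ true
  transfer zero _ ()
  transfer (suc x) p startA with half-split x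
  ... | t , inj₁ refl = transfer-odd t p startA
  ... | t , inj₂ refl = transfer-even t p startA

-- Two good words with the same code have the same blocks, hence are equal.
module Decoding (n : ℕ) (π π' : Word (suc n)) (g : Good π) (g' : Good π')
                (same : Encoding.encode π ≡ Encoding.encode π') where

  open import Data.Nat
  open import Data.Nat.Properties
  open import Data.Bool using (true; false)
  open import Relation.Binary.PropositionalEquality
  open BoundedSearch
  open Encoding

  module A = GoodWord n π g
  module B = GoodWord n π' g'
  module A→B = StartTransfer n π π' g g' same
  module B→A = StartTransfer n π' π g' g (sym same)
  N = suc n

  startsBlock-agree : ∀ s → s < N → A.startsBlock s ≡ B.startsBlock s
  startsBlock-agree s p = agree (A.startsBlock s) (B.startsBlock s) refl refl
    where
    agree : ∀ a b → A.startsBlock s ≡ a → B.startsBlock s ≡ b → A.startsBlock s ≡ B.startsBlock s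
    agree true _ eA _ = trans eA (sym (A→B.transfer s p eA))
    agree _ true _ eB = trans (B→A.transfer s p eB) (sym eB)
    agree false false eA eB = trans eA (sym eB)

  f-agree : ∀ x → x < N → A.f x ≡ B.f x
  f-agree x p = +-cancelʳ-≡ (A.blockStart x) _ _ (+-cancelʳ-≡ (A.blockEnd x) _ _ (begin
      A.f x + A.blockStart x + A.blockEnd x ≡⟨ A.block-formula x p ⟩
      N + x                                 ≡⟨ sym (B.block-formula x p) ⟩
      B.f x + B.blockStart x + B.blockEnd x ≡⟨ cong₂ (λ a b → B.f x + a + b) (sym start≡) (sym end≡) ⟩
      B.f x + A.blockStart x + A.blockEnd x ∎))
    where
    open ≡-Reasoning
    start≡ : A.blockStart x ≡ B.blockStart x
    start≡ = lastHit-cong A.startsBlock B.startsBlock x (λ s _ s≤x → startsBlock-agree s (≤-<-trans s≤x p))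
    end≡ : A.blockEnd x ≡ B.blockEnd x
    end≡ = A.blockEnd-cong B.startsBlock x p startsBlock-agree

  words-equal : π ≡ π'
  words-equal = asFunction-injective π π' f-agree

module Counting where

  open import Data.Nat
  open import Data.Nat.Properties
  open import Data.List using (List; length; filter; upTo; cartesianProduct)
  open import Data.List.Properties using (length-upTo)
  open import Data.List.Membership.Propositional using (_∈_)
  open import Data.List.Membership.Propositional.Properties using (∈-filter⁻; ∈-upTo⁺; ∈-cartesianProduct⁺)
  import Data.List.Relation.Unary.Unique.Propositional.Properties as Unique
  open import Data.Product using (proj₂)
  open import Relation.Binary.PropositionalEquality
  open import Data.Nat.Tactic.RingSolver using (solve-∀)
  open ListCounting
  open Encoding
  open Halves

  codes : ∀ N → List (Code N)
  codes N = cartesianProduct (upTo N) (cartesianProduct (upTo N) (allBitVecs ⌊ N /2⌋))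

  length-codes : ∀ N → length (codes N) ≡ N * (N * 2 ^ ⌊ N /2⌋)
  length-codes N =
    trans (length-cartesianProduct (upTo N) _)
      (cong₂ _*_ (length-upTo N)
        (trans (length-cartesianProduct (upTo N) _) (cong₂ _*_ (length-upTo N) (length-allBitVecs ⌊ N /2⌋))))

  -- encode is an injection from the good words into the codes
  C-bound : ∀ n → C (suc n) ≤ suc n * (suc n * 2 ^ ⌊ suc n /2⌋)
  C-bound n = subst (C (suc n) ≤_) (length-codes (suc n))
    (length-≤-injection encode goods (codes (suc n)) (Unique.filter⁺ good? (allVecs-unique (suc n))) into injective)
    where
    goods = filter good? (allVecs {suc n} (suc n))
    into : ∀ {π} → π ∈ goods → encode π ∈ codes (suc n)
    into _ = ∈-cartesianProduct⁺ (∈-upTo⁺ (threshold-< n _ 1))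
               (∈-cartesianProduct⁺ (∈-upTo⁺ (threshold-< n _ 2)) (allBitVecs-complete _))
    injective : ∀ {π π'} → π ∈ goods → π' ∈ goods → encode π ≡ encode π' → π ≡ π'
    injective m m' same =
      Decoding.words-equal n _ _ (proj₂ (∈-filter⁻ good? {xs = allVecs (suc n)} m))
                                 (proj₂ (∈-filter⁻ good? {xs = allVecs (suc n)} m')) same

  squared-bound : ∀ N c → c ≤ N * (N * 2 ^ ⌊ N /2⌋) → c * c ≤ N ^ 4 * 2 ^ N
  squared-bound N c c≤ = begin
      c * c                                     ≤⟨ *-mono-≤ c≤ c≤ ⟩
      N * (N * q) * (N * (N * q))               ≡⟨ regroup N q ⟩
      N * (N * (N * (N * 1))) * (q * q)         ≡⟨ cong (N ^ 4 *_) (sym (^-distribˡ-+-* 2 ⌊ N /2⌋ ⌊ N /2⌋)) ⟩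
      N ^ 4 * 2 ^ (⌊ N /2⌋ + ⌊ N /2⌋)           ≤⟨ *-monoʳ-≤ (N ^ 4) (^-monoʳ-≤ 2 (halves-≤ N)) ⟩
      N ^ 4 * 2 ^ N                             ∎
    where
    open ≤-Reasoning
    q = 2 ^ ⌊ N /2⌋
    regroup : ∀ N q → N * (N * q) * (N * (N * q)) ≡ N * (N * (N * (N * 1))) * (q * q)
    regroup = solve-∀

theorem1p9 : ∀ (n : ℕ) → 1 ≤ n → C n * C n ≤ (n ^ 4) * (2 ^ n)
theorem1p9 (suc n) _ = Counting.squared-bound (suc n) (C (suc n)) (Counting.C-bound n)
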